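{- (Soundness of the orthologic sequent calculus.) Let $(g,d)$ be a sequent of annotated orthologic terms. If $(g,d)$ is derivable in the orthologic sequent calculus $\mathsf{OL}$ (the rules below, including Cut), then for every ortholattice $(A,\le,\wedge,\vee,\neg,0,1)$ and every valuation $v$ from positive integers to $A$, we have $\iota_v(g) \le \neg\, \iota_v(d)$.
   Context: Terms: generated from variables $x_p$ ($p$ a positive integer) by binary $\wedge$ (meet), binary $\vee$ (join) and unary $\neg$ (negation). Annotated terms: $N$ (no formula), $L(t)$ ($t$ on the left), $R(t)$ ($t$ on the right), $t$ a term. A sequent is an ordered pair $(g,d)$ of annotated terms; e.g. $(L(\phi),R(\psi))$ stands for $\phi\vdash\psi$. An ortholattice is a structure $(A,\wedge,\vee,\neg,0,1)$ satisfying, for all $x,y,z$: $x\vee y=y\vee x$, $x\wedge y=y\wedge x$; $x\vee(y\vee z)=(x\vee y)\vee z$, $x\wedge(y\wedge z)=(x\wedge y)\wedge z$; $x\vee x=x$, $x\wedge x=x$; $x\vee 1=1$, $x\wedge 0=0$; $x\vee 0=x$, $x\wedge 1=x$; $\neg\neg x=x$; $x\vee\neg x=1$, $x\wedge\neg x=0$; $\neg(x\vee y)=\neg x\wedge\neg y$, $\neg(x\wedge y)=\neg x\vee\neg y$; $x\vee(x\wedge y)=x$, $x\wedge(x\vee y)=x$. Its order is $x\le y$ iff $x\wedge y=x$. For a valuation $v$, $\llbracket t\rrbracket_v\in A$ is the evaluation of term $t$ (variables by $v$, connectives by the ortholattice operations). Put $\iota_v(N)=1$, $\iota_v(L(t))=\llbracket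 t\rrbracket_v$, $\iota_v(R(t))=\neg\llbracket t\rrbracket_v$; thus $(L(s),R(t))$ is valid iff $\llbracket s\rrbracket_v\le\llbracket t\rrbracket_v$. Rules of $\mathsf{OL}$ (for annotated terms $g,d$ and terms $a,b$); a derivation is a finite tree of rule applications: Hyp: $(L(a),R(a))$ with no premise. Weaken: from $(g,N)$ infer $(g,d)$. Contract: from $(g,g)$ infer $(g,N)$. Swap: from $(g,d)$ infer $(d,g)$. LeftAnd1 / LeftAnd2: from $(L(a),d)$ (resp. $(L(b),d)$) infer $(L(a\wedge b),d)$. LeftOr: from $(L(a),d)$ and $(L(b),d)$ infer $(L(a\vee b),d)$. LeftNot: from $(R(a),d)$ infer $(L(\neg a),d)$. RightOr1 / RightOr2: from $(g,R(a))$ (resp. $(g,R(b))$) infer $(g,R(a\vee b))$. RightAnd: from $(g,R(a))$ and $(g,R(b))$ infer $(g,R(a\wedge b))$. RightNot: from $(g,L(a))$ infer $(g,R(\neg a))$. Cut: from $(g,R(b))$ and $(L(b),d)$ infer $(g,d)$. -}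

module Defs where

open import Level using (Level; suc; _⊔_)
open import Data.Nat using (ℕ; _≤_)
open import Data.Product using (Σ; _×_; _,_)
open import Relation.Binary.PropositionalEquality using (_≡_)

Pos : Set
Pos = Σ ℕ (λ p → 1 ≤ p)

data Term : Set where
  var  : Pos → Term
  _∧ₜ_ : Term → Term → Term
  _∨ₜ_ : Term → Term → Term
  ¬ₜ_  : Term → Term

data Ann : Set where
  N : Ann
  L : Term → Ann
  R : Term → Ann

Sequent : Set
Sequent = Ann × Ann

data OL : Ann → Ann → Set where
  hyp      : ∀ a → OL (L a) (R a)
  weaken   : ∀ {g} d → OL g N → OL g d
  contract : ∀ {g} → OL g g → OL g N
  swap     : ∀ {g d} → OL g d → OL d g
  leftAnd1 : ∀ {a} b {d} → OL (L a) d → OL (L (a ∧ₜ b)) d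
  leftAnd2 : ∀ a {b d} → OL (L b) d → OL (L (a ∧ₜ b)) d
  leftOr   : ∀ {a b d} → OL (L a) d → OL (L b) d → OL (L (a ∨ₜ b)) d
  leftNot  : ∀ {a d} → OL (R a) d → OL (L (¬ₜ a)) d
  rightOr1 : ∀ {g a} b → OL g (R a) → OL g (R (a ∨ₜ b))
  rightOr2 : ∀ {g} a {b} → OL g (R b) → OL g (R (a ∨ₜ b))
  rightAnd : ∀ {g a b} → OL g (R a) → OL g (R b) → OL g (R (a ∧ₜ b))
  rightNot : ∀ {g a} → OL g (L a) → OL g (R (¬ₜ a))
  cut      : ∀ {g d} b → OL g (R b) → OL (L b) d → OL g d

Derivable : Sequent → Set
Derivable (g , d) = OL g d

record Ortholattice (ℓ : Level) : Set (suc ℓ) where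
  infixr 7 _∧_
  infixr 6 _∨_
  field
    A   : Set ℓ
    _∧_ : A → A → A
    _∨_ : A → A → A
    ¬_  : A → A
    0#  : A
    1#  : A
    ∨-comm   : ∀ x y → x ∨ y ≡ y ∨ x
    ∧-comm   : ∀ x y → x ∧ y ≡ y ∧ x
    ∨-assoc  : ∀ x y z → x ∨ (y ∨ z) ≡ (x ∨ y) ∨ z
    ∧-assoc  : ∀ x y z → x ∧ (y ∧ z) ≡ (x ∧ y) ∧ z
    ∨-idem   : ∀ x → x ∨ x ≡ x
    ∧-idem   : ∀ x → x ∧ x ≡ x
    ∨-one    : ∀ x → x ∨ 1# ≡ 1#
    ∧-zero   : ∀ x → x ∧ 0# ≡ 0#
    ∨-zero   : ∀ x → x ∨ 0# ≡ x
    ∧-one    : ∀ x → x ∧ 1# ≡ x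
    ¬¬       : ∀ x → ¬ (¬ x) ≡ x
    ∨-compl  : ∀ x → x ∨ ¬ x ≡ 1#
    ∧-compl  : ∀ x → x ∧ ¬ x ≡ 0#
    deMorgan∨ : ∀ x y → ¬ (x ∨ y) ≡ ¬ x ∧ ¬ y
    deMorgan∧ : ∀ x y → ¬ (x ∧ y) ≡ ¬ x ∨ ¬ y
    absorb∨  : ∀ x y → x ∨ (x ∧ y) ≡ x
    absorb∧  : ∀ x y → x ∧ (x ∨ y) ≡ x

  _≤ₒ_ : A → A → Set ℓ
  x ≤ₒ y = x ∧ y ≡ x

module _ {ℓ : Level} (O : Ortholattice ℓ) where
  open Ortholattice O

  ⟦_⟧ : Term → (Pos → A) → A
  ⟦ var p ⟧ v = v p
  ⟦ a ∧ₜ b ⟧ v = ⟦ a ⟧ v ∧ ⟦ b ⟧ v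
  ⟦ a ∨ₜ b ⟧ v = ⟦ a ⟧ v ∨ ⟦ b ⟧ v
  ⟦ ¬ₜ a ⟧ v = ¬ ⟦ a ⟧ v

  ι : (Pos → A) → Ann → A
  ι v N = 1#
  ι v (L t) = ⟦ t ⟧ v
  ι v (R t) = ¬ ⟦ t ⟧ v

{-# OPTIONS --safe #-}
module Submission where

open import Defs
open import Level using (Level)
open import Data.Product using (_,_)
open import Relation.Binary.PropositionalEquality
  using (_≡_; sym; trans; cong; subst; module ≡-Reasoning)

-- Every rule is sound for the reading ι(g) ≤ ¬ ι(d): the left and right rules
-- are the lattice laws for ∧ and ∨ (with ¬¬x = x absorbing the negation that
-- R adds), Swap is the antitonicity of ¬, Cut is transitivity, and Weaken and
-- Contract hold because ι(g) ≤ ¬1 and ι(g) ≤ ¬ι(g) both force ι(g) = 0.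

module OrderProperties {ℓ : Level} (O : Ortholattice ℓ) where
  open Ortholattice O
  open ≡-Reasoning

  ≤-refl : ∀ x → x ≤ₒ x
  ≤-refl = ∧-idem

  ≤-trans : ∀ {x y z} → x ≤ₒ y → y ≤ₒ z → x ≤ₒ z
  ≤-trans {x} {y} {z} x≤y y≤z = begin
    x ∧ z        ≡⟨ cong (_∧ z) (sym x≤y) ⟩
    (x ∧ y) ∧ z  ≡⟨ sym (∧-assoc x y z) ⟩
    x ∧ (y ∧ z)  ≡⟨ cong (x ∧_) y≤z ⟩
    x ∧ y        ≡⟨ x≤y ⟩
    x            ∎

  ≤⇒∨≡ : ∀ {x y} → x ≤ₒ y → x ∨ y ≡ y
  ≤⇒∨≡ {x} {y} x≤y = begin
    x ∨ y        ≡⟨ ∨-comm x y ⟩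
    y ∨ x        ≡⟨ cong (y ∨_) (sym x≤y) ⟩
    y ∨ (x ∧ y)  ≡⟨ cong (y ∨_) (∧-comm x y) ⟩
    y ∨ (y ∧ x)  ≡⟨ absorb∨ y x ⟩
    y            ∎

  ∨≡⇒≤ : ∀ {x y} → x ∨ y ≡ y → x ≤ₒ y
  ∨≡⇒≤ {x} {y} x∨y≡y = trans (cong (x ∧_) (sym x∨y≡y)) (absorb∧ x y)

  x∧y≤x : ∀ x y → (x ∧ y) ≤ₒ x
  x∧y≤x x y = begin
    (x ∧ y) ∧ x  ≡⟨ ∧-comm (x ∧ y) x ⟩
    x ∧ (x ∧ y)  ≡⟨ ∧-assoc x x y ⟩
    (x ∧ x) ∧ y  ≡⟨ cong (_∧ y) (∧-idem x) ⟩
    x ∧ y        ∎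

  x∧y≤y : ∀ x y → (x ∧ y) ≤ₒ y
  x∧y≤y x y = subst (_≤ₒ y) (∧-comm y x) (x∧y≤x y x)

  x≤x∨y : ∀ x y → x ≤ₒ (x ∨ y)
  x≤x∨y = absorb∧

  y≤x∨y : ∀ x y → y ≤ₒ (x ∨ y)
  y≤x∨y x y = subst (y ≤ₒ_) (∨-comm y x) (x≤x∨y y x)

  ∨-least : ∀ {x y z} → x ≤ₒ z → y ≤ₒ z → (x ∨ y) ≤ₒ z
  ∨-least {x} {y} {z} x≤z y≤z = ∨≡⇒≤ (begin
    (x ∨ y) ∨ z  ≡⟨ sym (∨-assoc x y z) ⟩
    x ∨ (y ∨ z)  ≡⟨ cong (x ∨_) (≤⇒∨≡ y≤z) ⟩
    x ∨ z        ≡⟨ ≤⇒∨≡ x≤z ⟩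
    z            ∎)

  ∧-greatest : ∀ {x y z} → x ≤ₒ y → x ≤ₒ z → x ≤ₒ (y ∧ z)
  ∧-greatest {x} {y} {z} x≤y x≤z = begin
    x ∧ (y ∧ z)  ≡⟨ ∧-assoc x y z ⟩
    (x ∧ y) ∧ z  ≡⟨ cong (_∧ z) x≤y ⟩
    x ∧ z        ≡⟨ x≤z ⟩
    x            ∎

  0≤x : ∀ x → 0# ≤ₒ x
  0≤x x = trans (∧-comm 0# x) (∧-zero x)

  ¬1≡0 : ¬ 1# ≡ 0#
  ¬1≡0 = begin
    ¬ 1#              ≡⟨ cong ¬_ (sym (∨-compl 0#)) ⟩
    ¬ (0# ∨ ¬ 0#)     ≡⟨ deMorgan∨ 0# (¬ 0#) ⟩
    ¬ 0# ∧ ¬ (¬ 0#)   ≡⟨ cong (¬ 0# ∧_) (¬¬ 0#) ⟩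
    ¬ 0# ∧ 0#         ≡⟨ ∧-zero (¬ 0#) ⟩
    0#                ∎

  ¬-antitone : ∀ {x y} → x ≤ₒ y → (¬ y) ≤ₒ (¬ x)
  ¬-antitone {x} {y} x≤y = begin
    ¬ y ∧ ¬ x  ≡⟨ sym (deMorgan∨ y x) ⟩
    ¬ (y ∨ x)  ≡⟨ cong ¬_ (∨-comm y x) ⟩
    ¬ (x ∨ y)  ≡⟨ cong ¬_ (≤⇒∨≡ x≤y) ⟩
    ¬ y        ∎

  x≤¬y⇒y≤¬x : ∀ {x y} → x ≤ₒ (¬ y) → y ≤ₒ (¬ x)
  x≤¬y⇒y≤¬x {x} {y} x≤¬y = subst (_≤ₒ (¬ x)) (¬¬ y) (¬-antitone x≤¬y)

  x≤y⇒x≤¬¬y : ∀ {x y} → x ≤ₒ y → x ≤ₒ (¬ (¬ y))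
  x≤y⇒x≤¬¬y {x} {y} = subst (x ≤ₒ_) (sym (¬¬ y))

  x≤¬¬y⇒x≤y : ∀ {x y} → x ≤ₒ (¬ (¬ y)) → x ≤ₒ y
  x≤¬¬y⇒x≤y {x} {y} = subst (x ≤ₒ_) (¬¬ y)

  x≤¬1⇒x≤0 : ∀ {x} → x ≤ₒ (¬ 1#) → x ≤ₒ 0#
  x≤¬1⇒x≤0 {x} = subst (x ≤ₒ_) ¬1≡0

  x≤¬x⇒x≤0 : ∀ {x} → x ≤ₒ (¬ x) → x ≤ₒ 0#
  x≤¬x⇒x≤0 {x} x≤¬x = subst (x ≤ₒ_) (∧-compl x) (∧-greatest (≤-refl x) x≤¬x)

module _ {ℓ : Level} (O : Ortholattice ℓ) where
  open Ortholattice O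
  open OrderProperties O

  OL-sound : ∀ {g d} → OL g d → (v : Pos → A) → ι O v g ≤ₒ (¬ ι O v d)
  OL-sound (hyp a)        v = x≤y⇒x≤¬¬y (≤-refl _)
  OL-sound (weaken d p)   v = ≤-trans (x≤¬1⇒x≤0 (OL-sound p v)) (0≤x _)
  OL-sound (contract p)   v = ≤-trans (x≤¬x⇒x≤0 (OL-sound p v)) (0≤x _)
  OL-sound (swap p)       v = x≤¬y⇒y≤¬x (OL-sound p v)
  OL-sound (leftAnd1 b p) v = ≤-trans (x∧y≤x _ _) (OL-sound p v)
  OL-sound (leftAnd2 a p) v = ≤-trans (x∧y≤y _ _) (OL-sound p v)
  OL-sound (leftOr p q)   v = ∨-least (OL-sound p v) (OL-sound q v)
  OL-sound (leftNot p)    v = OL-sound p v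
  OL-sound (rightOr1 b p) v = x≤y⇒x≤¬¬y (≤-trans (x≤¬¬y⇒x≤y (OL-sound p v)) (x≤x∨y _ _))
  OL-sound (rightOr2 a p) v = x≤y⇒x≤¬¬y (≤-trans (x≤¬¬y⇒x≤y (OL-sound p v)) (y≤x∨y _ _))
  OL-sound (rightAnd p q) v =
    x≤y⇒x≤¬¬y (∧-greatest (x≤¬¬y⇒x≤y (OL-sound p v)) (x≤¬¬y⇒x≤y (OL-sound q v)))
  OL-sound (rightNot p)   v = x≤y⇒x≤¬¬y (OL-sound p v)
  OL-sound (cut b p q)    v = ≤-trans (x≤¬¬y⇒x≤y (OL-sound p v)) (OL-sound q v)

mainTheorem1 : ∀ {ℓ : Level} (g d : Ann) → Derivable (g , d) →
    (O : Ortholattice ℓ) (v : Pos → Ortholattice.A O) →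
    Ortholattice._≤ₒ_ O (ι O v g) (Ortholattice.¬_ O (ι O v d))
mainTheorem1 g d derivation O v = OL-sound O derivation v
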